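{- Let $\mathcal{R}$ be a (generic) rectangulation of size $n$ whose rectangles carry the NW--SE labeling $r_1,\dots,r_n$, and let $\prec_s$ be the transitive closure of the relation $\blacktriangleleft$ on $[n]$ defined below. Then $\prec_s$ is a partial order on $[n]$.
   Context: A rectangulation of an axis-aligned rectangle $R$ is a decomposition of $R$ into finitely many interior-disjoint axis-aligned rectangles; its size is the number of rectangles. A segment is a maximal straight line segment that is a union of sides of rectangles and is not contained in a side of $R$. Rectangulations are assumed generic: no point is a corner of four rectangles. Rectangle $r$ is on the left of $r'$ if there is a sequence $r=r^1,\dots,r^k=r'$ of rectangles such that the right side of $r^i$ and the left side of $r^{i+1}$ lie in a common segment for all $i$; $r$ is below $r'$ (i.e. $r'$ is above $r$) if there is such a sequence where the top side of $r^i$ and the bottom side of $r^{i+1}$ lie in a common segment. Any two distinct rectangles are related by exactly one of these two relations (in one direction). The NW--SE labeling labels the rectangles $r_1,\dots,r_n$ so that $i<j$ iff $r_i$ is on the left of or above $r_j$. Two rectangles are adjacent if their boundaries share a segment of positive length. For $a,b\in[n]$ set $a\blacktriangleleft b$ if one of the following holds: (1) $r_a,r_b$ are adjacent and $r_a$ is on the left of $r_b$; (2) $r_a,r_b$ are adjacent and $r_a$ is below $r_b$; (3) the right side of $r_b$ and the left side of $r_a$ lie on the same vertical segment, and the bottom-right corner of $r_b$ lies above the top-left corner of $r_a$ on this segment; (4) the top side of $r_b$ and the bottom side of $r_a$ lie on the same horizontal segment, and the top-left corner of $r_b$ lies to the right of the bottom-right corner of $r_a$ on this segment.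
   Formalization: The rectangle R and all rectangles of the rectangulation have rational corner coordinates, with covering and interior-disjointness required only at points with rational coordinates. -}

module Defs where

open import Data.Nat using (ℕ)
open import Data.Fin using (Fin)
open import Data.Rational using (ℚ; _<_; _≤_; _⊔_; _⊓_)
open import Data.Product using (Σ; ∃; ∃-syntax; _×_; _,_)
open import Data.Sum using (_⊎_)
open import Relation.Nullary using (¬_)
open import Relation.Binary.PropositionalEquality using (_≡_; _≢_)
open import Relation.Binary.Construct.Closure.Transitive using (TransClosure)

_∈[_,_] : ℚ → ℚ → ℚ → Set
y ∈[ a , b ] = (a ≤ y) × (y ≤ b)

_⊆[_,_] : ℚ × ℚ → ℚ → ℚ → Set
(a , b) ⊆[ c , d ] = (c ≤ a) × (b ≤ d)

record Rect : Set where
  field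
    x₀ x₁ y₀ y₁ : ℚ
    x₀<x₁ : x₀ < x₁
    y₀<y₁ : y₀ < y₁
open Rect public

_∈R_ : ℚ × ℚ → Rect → Set
(px , py) ∈R r = (px ∈[ x₀ r , x₁ r ]) × (py ∈[ y₀ r , y₁ r ])

_∈Int_ : ℚ × ℚ → Rect → Set
(px , py) ∈Int r = (x₀ r < px) × (px < x₁ r) × (y₀ r < py) × (py < y₁ r)

IsCorner : ℚ × ℚ → Rect → Set
IsCorner (px , py) r = (px ≡ x₀ r ⊎ px ≡ x₁ r) × (py ≡ y₀ r ⊎ py ≡ y₁ r)

record Rectangulation (n : ℕ) : Set where
  field
    outer     : Rect
    rect      : Fin n → Rect
    inside    : ∀ i p → p ∈R rect i → p ∈R outer
    disjoint  : ∀ i j → i ≢ j → ∀ p → ¬ ((p ∈Int rect i) × (p ∈Int rect j))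
    cover     : ∀ p → p ∈R outer → ∃[ i ] (p ∈R rect i)
    generic   : ∀ p (a b c d : Fin n) →
                a ≢ b → a ≢ c → a ≢ d → b ≢ c → b ≢ d → c ≢ d →
                ¬ (IsCorner p (rect a) × IsCorner p (rect b) ×
                   IsCorner p (rect c) × IsCorner p (rect d))

module _ {n : ℕ} (ℛ : Rectangulation n) where
  open Rectangulation ℛ

  r : Fin n → Rect
  r = rect

  VUnionOfSides : ℚ → ℚ → ℚ → Set
  VUnionOfSides c s₀ s₁ =
    (s₀ < s₁) ×
    (∀ y → y ∈[ s₀ , s₁ ] →
       ∃[ i ] ((x₀ (r i) ≡ c ⊎ x₁ (r i) ≡ c) × y ∈[ y₀ (r i) , y₁ (r i) ] ×
               (y₀ (r i) , y₁ (r i)) ⊆[ s₀ , s₁ ]))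

  HUnionOfSides : ℚ → ℚ → ℚ → Set
  HUnionOfSides c s₀ s₁ =
    (s₀ < s₁) ×
    (∀ x → x ∈[ s₀ , s₁ ] →
       ∃[ i ] ((y₀ (r i) ≡ c ⊎ y₁ (r i) ≡ c) × x ∈[ x₀ (r i) , x₁ (r i) ] ×
               (x₀ (r i) , x₁ (r i)) ⊆[ s₀ , s₁ ]))

  -- A vertical segment {c} × [s₀,s₁]: maximal union of sides, not contained in a side of R.
  VSegment : ℚ → ℚ → ℚ → Set
  VSegment c s₀ s₁ =
    VUnionOfSides c s₀ s₁ ×
    (∀ t₀ t₁ → VUnionOfSides c t₀ t₁ → (s₀ , s₁) ⊆[ t₀ , t₁ ] → (t₀ ≡ s₀) × (t₁ ≡ s₁)) ×
    (c ≢ x₀ outer) × (c ≢ x₁ outer)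

  HSegment : ℚ → ℚ → ℚ → Set
  HSegment c s₀ s₁ =
    HUnionOfSides c s₀ s₁ ×
    (∀ t₀ t₁ → HUnionOfSides c t₀ t₁ → (s₀ , s₁) ⊆[ t₀ , t₁ ] → (t₀ ≡ s₀) × (t₁ ≡ s₁)) ×
    (c ≢ y₀ outer) × (c ≢ y₁ outer)

  RightLeftSeg : Fin n → Fin n → Set
  RightLeftSeg a b = ∃[ c ] ∃[ s₀ ] ∃[ s₁ ] (VSegment c s₀ s₁ ×
    x₁ (r a) ≡ c × (y₀ (r a) , y₁ (r a)) ⊆[ s₀ , s₁ ] ×
    x₀ (r b) ≡ c × (y₀ (r b) , y₁ (r b)) ⊆[ s₀ , s₁ ])

  TopBottomSeg : Fin n → Fin n → Set
  TopBottomSeg a b = ∃[ c ] ∃[ s₀ ] ∃[ s₁ ] (HSegment c s₀ s₁ ×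
    y₁ (r a) ≡ c × (x₀ (r a) , x₁ (r a)) ⊆[ s₀ , s₁ ] ×
    y₀ (r b) ≡ c × (x₀ (r b) , x₁ (r b)) ⊆[ s₀ , s₁ ])

  LeftOf : Fin n → Fin n → Set
  LeftOf = TransClosure RightLeftSeg

  Below : Fin n → Fin n → Set
  Below = TransClosure TopBottomSeg

  NWSELabeling : Set
  NWSELabeling = ∀ (i j : Fin n) →
    ((Data.Fin._<_ i j → LeftOf i j ⊎ Below j i) ×
     (LeftOf i j ⊎ Below j i → Data.Fin._<_ i j))

  -- boundaries share a segment of positive length (some vertical sides overlap,
  -- or some horizontal sides overlap, in positive length)
  Adjacent : Fin n → Fin n → Set
  Adjacent a b =
    (((x₀ (r a) ≡ x₀ (r b)) ⊎ (x₀ (r a) ≡ x₁ (r b)) ⊎ (x₁ (r a) ≡ x₀ (r b)) ⊎ (x₁ (r a) ≡ x₁ (r b))) ×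
      ((y₀ (r a) ⊔ y₀ (r b)) < (y₁ (r a) ⊓ y₁ (r b))))
    ⊎
    (((y₀ (r a) ≡ y₀ (r b)) ⊎ (y₀ (r a) ≡ y₁ (r b)) ⊎ (y₁ (r a) ≡ y₀ (r b)) ⊎ (y₁ (r a) ≡ y₁ (r b))) ×
      ((x₀ (r a) ⊔ x₀ (r b)) < (x₁ (r a) ⊓ x₁ (r b))))

  _◀_ : Fin n → Fin n → Set
  a ◀ b =
    (Adjacent a b × LeftOf a b) ⊎
    (Adjacent a b × Below a b) ⊎
    -- (3) right side of r b and left side of r a on a common vertical segment,
    --     bottom-right corner of r b strictly above top-left corner of r a
    (RightLeftSeg b a × (y₁ (r a) < y₀ (r b))) ⊎
    -- (4) top side of r b and bottom side of r a on a common horizontal segment,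
    --     top-left corner of r b strictly to the right of bottom-right corner of r a
    (TopBottomSeg b a × (x₁ (r a) < x₀ (r b)))

  _≺ₛ_ : Fin n → Fin n → Set
  _≺ₛ_ = TransClosure _◀_

{-# OPTIONS --safe #-}
-- Every clause of ◀ forces the purely metric relation a ◁ b: the bottom-right corner of a
-- lies weakly south-west of the top-left corner of b, or the top-left corner of a lies weakly
-- south-west of the bottom-right corner of b, strictly in at least one coordinate. So it is
-- enough that ◁ has no cycle through pairwise interior-disjoint rectangles. On a cycle pick m
-- with smallest right coordinate x₁. Its predecessor t must then lie below m, and comparing t
-- with the successor w of m along whichever axis separates them gives t ◁ w (t = w is ruled out
-- by asymmetry of ◁). Cutting m out leaves a shorter cycle, so induction on the length
-- concludes.
module Submission where

open import Data.Empty using (⊥; ⊥-elim)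
open import Data.Fin using (Fin; _≟_)
open import Data.List using (List; []; _∷_; _++_; length)
open import Data.List.Membership.Propositional using (_∈_)
open import Data.List.Relation.Unary.All using (All; []; _∷_)
open import Data.List.Relation.Unary.Any using (here; there)
open import Data.List.Relation.Binary.Permutation.Propositional using (_↭_; ↭-refl)
open import Data.List.Relation.Binary.Permutation.Propositional.Properties
  using (All-resp-↭; ↭-length; ++-comm)
import Data.List.Extrema as Extrema
open import Data.Nat using (ℕ) renaming (_<_ to _<ℕ_)
open import Data.Nat.Induction using (<-wellFounded)
open import Data.Nat.Properties using (suc-injective) renaming (≤-reflexive to ≤ℕ-reflexive)
open import Data.Product using (∃-syntax; _×_; _,_; proj₁; proj₂)
open import Data.Rational using (ℚ; _<_; _≤_; _⊔_; _⊓_)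
open import Data.Rational.Properties
  using (≤-trans; ≤-reflexive; <⇒≤; ≰⇒>; _≤?_; ≤-total; <-≤-trans; ≤-<-trans; <-irrefl; <-dense;
         p≤p⊔q; p≤q⊔p; p⊓q≤p; p⊓q≤q; ≤-decTotalOrder; module ≤-Reasoning)
open import Data.Sum using (_⊎_; inj₁; inj₂)
open import Induction.WellFounded using (Acc; acc)
open import Relation.Binary
  using (Rel; TotalOrder; DecTotalOrder; DecidableEquality; Asymmetric; Irreflexive; _⇒_)
open import Relation.Binary.Construct.Closure.Transitive using (TransClosure; [_]; _∷_; transitive)
open import Relation.Binary.PropositionalEquality
  using (_≡_; _≢_; refl; sym; trans; isEquivalence; resp₂)
open import Relation.Binary.Structures using (IsStrictPartialOrder)
open import Relation.Nullary using (yes; no)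
open import Function using (_$_; _∘_)

open import Defs

open ≤-Reasoning

Path : ∀ {a ℓ} {A : Set a} → Rel A ℓ → A → List A → A → Set ℓ
Path _∼_ x []       y = x ∼ y
Path _∼_ x (v ∷ vs) y = x ∼ v × Path _∼_ v vs y

module _ {a ℓ} {A : Set a} {_∼_ : Rel A ℓ} where

  TransClosure⇒Path : ∀ {x y} → TransClosure _∼_ x y → ∃[ vs ] Path _∼_ x vs y
  TransClosure⇒Path [ x∼y ] = [] , x∼y
  TransClosure⇒Path (_∷_ {y = v} x∼v v∼⁺y) =
    let vs , p = TransClosure⇒Path v∼⁺y in v ∷ vs , x∼v , p

  Path-++ : ∀ {x y z} us {vs} → Path _∼_ x us y → Path _∼_ y vs z →
            Path _∼_ x (us ++ y ∷ vs) z
  Path-++ []       x∼y       q = x∼y , q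
  Path-++ (u ∷ us) (x∼u , p) q = x∼u , Path-++ us p q

  Path-split : ∀ {x y z} vs → Path _∼_ x vs z → y ∈ vs →
               ∃[ us ] ∃[ ws ] (vs ≡ us ++ y ∷ ws × Path _∼_ x us y × Path _∼_ y ws z)
  Path-split (v ∷ vs) (x∼v , p) (here refl) = [] , vs , refl , x∼v , p
  Path-split (v ∷ vs) (x∼v , p) (there y∈vs) with Path-split vs p y∈vs
  ... | us , ws , refl , p₁ , p₂ = v ∷ us , ws , refl , (x∼v , p₁) , p₂

  cycle-rotate : ∀ {x y} vs → Path _∼_ x vs x → y ∈ x ∷ vs →
                 ∃[ ws ] (x ∷ vs ↭ y ∷ ws × Path _∼_ y ws y)
  cycle-rotate     vs cyc (here refl)  = vs , ↭-refl , cyc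
  cycle-rotate {x} vs cyc (there y∈vs) with Path-split vs cyc y∈vs
  ... | us , ws , refl , p₁ , p₂ = ws ++ x ∷ us , ++-comm (x ∷ us) (_ ∷ ws) , Path-++ ws p₂ p₁

TransClosure-map : ∀ {a ℓ₁ ℓ₂} {A : Set a} {R : Rel A ℓ₁} {S : Rel A ℓ₂} →
                   R ⇒ S → TransClosure R ⇒ TransClosure S
TransClosure-map R⇒S [ xRy ]      = [ R⇒S xRy ]
TransClosure-map R⇒S (xRy ∷ yR⁺z) = R⇒S xRy ∷ TransClosure-map R⇒S yR⁺z

module _ {c ℓ₁ ℓ₂} (O : TotalOrder c ℓ₁ ℓ₂) where
  open TotalOrder O using (Carrier) renaming (_≤_ to _≼_)
  open Extrema O using (argmin; argmin-sel; f[argmin]≤f[⊤]; f[argmin]≤f[xs])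

  argmin∈ : ∀ {a} {A : Set a} (f : A → Carrier) x vs → argmin f x vs ∈ x ∷ vs
  argmin∈ f x vs with argmin-sel f x vs
  ... | inj₁ m≡x  = here m≡x
  ... | inj₂ m∈vs = there m∈vs

  argmin-minimal : ∀ {a} {A : Set a} (f : A → Carrier) x vs →
                   All (λ v → f (argmin f x vs) ≼ f v) (x ∷ vs)
  argmin-minimal f x vs = f[argmin]≤f[⊤] {f = f} x vs ∷ f[argmin]≤f[xs] {f = f} x vs

  module _ {a ℓ} {A : Set a} (_∼_ : Rel A ℓ) (_≟ᴬ_ : DecidableEquality A) (f : A → Carrier)
           (∼-asym : Asymmetric _∼_)
           (bypass : ∀ {t m w} → t ∼ m → m ∼ w → f m ≼ f t → f m ≼ f w → t ≢ w → t ∼ w)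
           where

    Path-bypass : ∀ {m w} → m ∼ w → f m ≼ f w →
                  ∀ {u} vs → Path _∼_ u vs m → All (λ v → f m ≼ f v) (u ∷ vs) → Path _∼_ u vs w
    Path-bypass {w = w} m∼w m≼w {u} [] u∼m (m≼u ∷ []) with u ≟ᴬ w
    ... | yes refl = ⊥-elim (∼-asym u∼m m∼w)
    ... | no  u≢w  = bypass u∼m m∼w m≼u m≼w u≢w
    Path-bypass m∼w m≼w (v ∷ vs) (u∼v , p) (_ ∷ m≼vs) = u∼v , Path-bypass m∼w m≼w vs p m≼vs

    no-cycle : ∀ {x} vs → Acc _<ℕ_ (length vs) → Path _∼_ x vs x → ⊥
    no-cycle {x} vs (acc shorter) cyc with cycle-rotate vs cyc (argmin∈ f x vs)
    ... | []     , _    , m∼m       = ∼-asym m∼m m∼m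
    ... | w ∷ ws , perm , (m∼w , p) with All-resp-↭ perm (argmin-minimal f x vs)
    ...   | _ ∷ m≼w∷ws@(m≼w ∷ _) =
      no-cycle ws (shorter (≤ℕ-reflexive (suc-injective (sym (↭-length perm)))))
                  (Path-bypass m∼w m≼w ws p m≼w∷ws)

    TransClosure-irreflexive : Irreflexive _≡_ (TransClosure _∼_)
    TransClosure-irreflexive refl x∼⁺x =
      let vs , cyc = TransClosure⇒Path x∼⁺x in no-cycle vs (<-wellFounded (length vs)) cyc

common-point : ∀ {a b c d : ℚ} → a < b → c < d → a < d → c < b →
               ∃[ p ] ((a < p × p < b) × (c < p × p < d))
common-point {a} {b} {c} {d} a<b c<d a<d c<b with ≤-total a c | ≤-total b d
... | inj₁ a≤c | inj₁ b≤d = let p , c<p , p<b = <-dense c<b in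
  p , (≤-<-trans a≤c c<p , p<b) , (c<p , <-≤-trans p<b b≤d)
... | inj₁ a≤c | inj₂ d≤b = let p , c<p , p<d = <-dense c<d in
  p , (≤-<-trans a≤c c<p , <-≤-trans p<d d≤b) , (c<p , p<d)
... | inj₂ c≤a | inj₁ b≤d = let p , a<p , p<b = <-dense a<b in
  p , (a<p , p<b) , (≤-<-trans c≤a a<p , <-≤-trans p<b b≤d)
... | inj₂ c≤a | inj₂ d≤b = let p , a<p , p<d = <-dense a<d in
  p , (a<p , <-≤-trans p<d d≤b) , (≤-<-trans c≤a a<p , p<d)

⊔<⊓⇒< : ∀ p q r s → p ⊔ q < r ⊓ s → p < s × q < r
⊔<⊓⇒< p q r s h =
  ≤-<-trans (p≤p⊔q p q) (<-≤-trans h (p⊓q≤q r s)) , ≤-<-trans (p≤q⊔p p q) (<-≤-trans h (p⊓q≤p r s))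

data Separated (a b : Rect) : Set where
  leftOf  : x₁ a ≤ x₀ b → Separated a b
  rightOf : x₁ b ≤ x₀ a → Separated a b
  below   : y₁ a ≤ y₀ b → Separated a b
  above   : y₁ b ≤ y₀ a → Separated a b

separated⊎overlapping : ∀ a b → Separated a b ⊎ ∃[ p ] (p ∈Int a × p ∈Int b)
separated⊎overlapping a b with x₁ a ≤? x₀ b | x₁ b ≤? x₀ a | y₁ a ≤? y₀ b | y₁ b ≤? y₀ a
... | yes h | _     | _     | _     = inj₁ (leftOf h)
... | no _  | yes h | _     | _     = inj₁ (rightOf h)
... | no _  | no _  | yes h | _     = inj₁ (below h)
... | no _  | no _  | no _  | yes h = inj₁ (above h)
... | no h₁ | no h₂ | no h₃ | no h₄
  with common-point (x₀<x₁ a) (x₀<x₁ b) (≰⇒> h₂) (≰⇒> h₁)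
     | common-point (y₀<y₁ a) (y₀<y₁ b) (≰⇒> h₄) (≰⇒> h₃)
... | px , (ax₀ , ax₁) , (bx₀ , bx₁) | py , (ay₀ , ay₁) , (by₀ , by₁) =
  inj₂ ((px , py) , (ax₀ , ax₁ , ay₀ , ay₁) , (bx₀ , bx₁ , by₀ , by₁))

infix 4 _⊏_ _◁_

_⊏_ : ℚ × ℚ → ℚ × ℚ → Set
(x , y) ⊏ (x′ , y′) = (x ≤ x′ × y < y′) ⊎ (x < x′ × y ≤ y′)

⊏⇒≤ : ∀ {x y x′ y′} → (x , y) ⊏ (x′ , y′) → x ≤ x′ × y ≤ y′
⊏⇒≤ (inj₁ (x≤x′ , y<y′)) = x≤x′ , <⇒≤ y<y′
⊏⇒≤ (inj₂ (x<x′ , y≤y′)) = <⇒≤ x<x′ , y≤y′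

⊏-asym : Asymmetric _⊏_
⊏-asym {_ , _} {_ , _} (inj₁ (_ , y<y′)) q = <-irrefl refl (<-≤-trans y<y′ (proj₂ (⊏⇒≤ q)))
⊏-asym {_ , _} {_ , _} (inj₂ (x<x′ , _)) q = <-irrefl refl (<-≤-trans x<x′ (proj₁ (⊏⇒≤ q)))

topLeft bottomRight : Rect → ℚ × ℚ
topLeft     a = x₀ a , y₁ a
bottomRight a = x₁ a , y₀ a

data _◁_ (a b : Rect) : Set where
  rightwards : bottomRight a ⊏ topLeft b → a ◁ b
  upwards    : topLeft a ⊏ bottomRight b → a ◁ b

◁-asym : Asymmetric _◁_
◁-asym {a} {b} (rightwards p) (rightwards q) = <-irrefl refl $ begin-strict
  x₁ a ≤⟨ proj₁ (⊏⇒≤ p) ⟩ x₀ b <⟨ x₀<x₁ b ⟩ x₁ b ≤⟨ proj₁ (⊏⇒≤ q) ⟩ x₀ a <⟨ x₀<x₁ a ⟩ x₁ a ∎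
◁-asym (rightwards p) (upwards q) = ⊏-asym p q
◁-asym (upwards p) (rightwards q) = ⊏-asym p q
◁-asym {a} {b} (upwards p) (upwards q) = <-irrefl refl $ begin-strict
  y₁ a ≤⟨ proj₂ (⊏⇒≤ p) ⟩ y₀ b <⟨ y₀<y₁ b ⟩ y₁ b ≤⟨ proj₂ (⊏⇒≤ q) ⟩ y₀ a <⟨ y₀<y₁ a ⟩ y₁ a ∎

◁-x₁-nonincreasing⇒below : ∀ {t m} → t ◁ m → x₁ m ≤ x₁ t → x₀ t ≤ x₁ m × y₁ t ≤ y₀ m
◁-x₁-nonincreasing⇒below {t} {m} (rightwards p) x₁m≤x₁t = ⊥-elim $ <-irrefl refl $ begin-strict
  x₁ t ≤⟨ proj₁ (⊏⇒≤ p) ⟩ x₀ m <⟨ x₀<x₁ m ⟩ x₁ m ≤⟨ x₁m≤x₁t ⟩ x₁ t ∎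
◁-x₁-nonincreasing⇒below (upwards p) _ = ⊏⇒≤ p

below-bypass : ∀ {t m w} → x₀ t ≤ x₁ m × y₁ t ≤ y₀ m → m ◁ w → x₁ m ≤ x₁ w → Separated t w → t ◁ w
below-bypass {t} {m} {w} (x₀t≤x₁m , y₁t≤y₀m) (upwards q) x₁m≤x₁w _ =
  upwards (inj₁ (≤-trans x₀t≤x₁m x₁m≤x₁w , (begin-strict
    y₁ t ≤⟨ y₁t≤y₀m ⟩ y₀ m <⟨ y₀<y₁ m ⟩ y₁ m ≤⟨ proj₂ (⊏⇒≤ q) ⟩ y₀ w ∎)))
below-bypass {t} {m} {w} (x₀t≤x₁m , y₁t≤y₀m) (rightwards q) _ sep with ⊏⇒≤ q | sep
... | _ , y₀m≤y₁w | leftOf x₁t≤x₀w = rightwards (inj₁ (x₁t≤x₀w , (begin-strict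
  y₀ t <⟨ y₀<y₁ t ⟩ y₁ t ≤⟨ y₁t≤y₀m ⟩ y₀ m ≤⟨ y₀m≤y₁w ⟩ y₁ w ∎)))
... | x₁m≤x₀w , _ | rightOf x₁w≤x₀t = ⊥-elim $ <-irrefl refl $ begin-strict
  x₀ w <⟨ x₀<x₁ w ⟩ x₁ w ≤⟨ x₁w≤x₀t ⟩ x₀ t ≤⟨ x₀t≤x₁m ⟩ x₁ m ≤⟨ x₁m≤x₀w ⟩ x₀ w ∎
... | x₁m≤x₀w , _ | below y₁t≤y₀w = upwards (inj₂ ((begin-strict
  x₀ t ≤⟨ x₀t≤x₁m ⟩ x₁ m ≤⟨ x₁m≤x₀w ⟩ x₀ w <⟨ x₀<x₁ w ⟩ x₁ w ∎) , y₁t≤y₀w))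
... | _ , y₀m≤y₁w | above y₁w≤y₀t = ⊥-elim $ <-irrefl refl $ begin-strict
  y₀ t <⟨ y₀<y₁ t ⟩ y₁ t ≤⟨ y₁t≤y₀m ⟩ y₀ m ≤⟨ y₀m≤y₁w ⟩ y₁ w ≤⟨ y₁w≤y₀t ⟩ y₀ t ∎

◁-bypass : ∀ {t m w} → t ◁ m → m ◁ w → x₁ m ≤ x₁ t → x₁ m ≤ x₁ w → Separated t w → t ◁ w
◁-bypass t◁m m◁w x₁m≤x₁t = below-bypass (◁-x₁-nonincreasing⇒below t◁m x₁m≤x₁t) m◁w

module _ {n : ℕ} (ℛ : Rectangulation n) where
  open Rectangulation ℛ

  separated : ∀ {i j} → i ≢ j → Separated (rect i) (rect j)
  separated {i} {j} i≢j with separated⊎overlapping (rect i) (rect j)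
  ... | inj₁ sep             = sep
  ... | inj₂ (p , p∈i , p∈j) = ⊥-elim (disjoint i j i≢j p (p∈i , p∈j))

  rightLeft⇒x₁≡x₀ : ∀ {a b} → RightLeftSeg ℛ a b → x₁ (rect a) ≡ x₀ (rect b)
  rightLeft⇒x₁≡x₀ (_ , _ , _ , _ , x₁a≡c , _ , x₀b≡c , _) = trans x₁a≡c (sym x₀b≡c)

  topBottom⇒y₁≡y₀ : ∀ {a b} → TopBottomSeg ℛ a b → y₁ (rect a) ≡ y₀ (rect b)
  topBottom⇒y₁≡y₀ (_ , _ , _ , _ , y₁a≡c , _ , y₀b≡c , _) = trans y₁a≡c (sym y₀b≡c)

  leftOf⇒x₁≤x₀ : ∀ {a b} → LeftOf ℛ a b → x₁ (rect a) ≤ x₀ (rect b)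
  leftOf⇒x₁≤x₀ [ seg ] = ≤-reflexive (rightLeft⇒x₁≡x₀ seg)
  leftOf⇒x₁≤x₀ {a} {b} (_∷_ {y = c} seg c-left-b) = begin
    x₁ (rect a) ≡⟨ rightLeft⇒x₁≡x₀ seg ⟩
    x₀ (rect c) ≤⟨ <⇒≤ (x₀<x₁ (rect c)) ⟩
    x₁ (rect c) ≤⟨ leftOf⇒x₁≤x₀ c-left-b ⟩
    x₀ (rect b) ∎

  below⇒y₁≤y₀ : ∀ {a b} → Below ℛ a b → y₁ (rect a) ≤ y₀ (rect b)
  below⇒y₁≤y₀ [ seg ] = ≤-reflexive (topBottom⇒y₁≡y₀ seg)
  below⇒y₁≤y₀ {a} {b} (_∷_ {y = c} seg c-below-b) = begin
    y₁ (rect a) ≡⟨ topBottom⇒y₁≡y₀ seg ⟩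
    y₀ (rect c) ≤⟨ <⇒≤ (y₀<y₁ (rect c)) ⟩
    y₁ (rect c) ≤⟨ below⇒y₁≤y₀ c-below-b ⟩
    y₀ (rect b) ∎

  adjacent-beside : ∀ {a b} → Adjacent ℛ a b →
                    x₁ (rect a) ≤ x₀ (rect b) → y₀ (rect a) < y₁ (rect b)
  adjacent-beside {a} {b} (inj₁ (_ , y-overlap)) _ =
    proj₁ (⊔<⊓⇒< (y₀ (rect a)) (y₀ (rect b)) (y₁ (rect a)) (y₁ (rect b)) y-overlap)
  adjacent-beside {a} {b} (inj₂ (_ , x-overlap)) x₁a≤x₀b = ⊥-elim (<-irrefl refl (<-≤-trans
    (proj₂ (⊔<⊓⇒< (x₀ (rect a)) (x₀ (rect b)) (x₁ (rect a)) (x₁ (rect b)) x-overlap)) x₁a≤x₀b))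

  adjacent-stacked : ∀ {a b} → Adjacent ℛ a b →
                     y₁ (rect a) ≤ y₀ (rect b) → x₀ (rect a) < x₁ (rect b)
  adjacent-stacked {a} {b} (inj₂ (_ , x-overlap)) _ =
    proj₁ (⊔<⊓⇒< (x₀ (rect a)) (x₀ (rect b)) (x₁ (rect a)) (x₁ (rect b)) x-overlap)
  adjacent-stacked {a} {b} (inj₁ (_ , y-overlap)) y₁a≤y₀b = ⊥-elim (<-irrefl refl (<-≤-trans
    (proj₂ (⊔<⊓⇒< (y₀ (rect a)) (y₀ (rect b)) (y₁ (rect a)) (y₁ (rect b)) y-overlap)) y₁a≤y₀b))

  _◁ᵢ_ : Rel (Fin n) _
  i ◁ᵢ j = rect i ◁ rect j

  ◀⇒◁ᵢ : _◀_ ℛ ⇒ _◁ᵢ_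
  ◀⇒◁ᵢ (inj₁ (adj , a-left-b)) =
    let x₁a≤x₀b = leftOf⇒x₁≤x₀ a-left-b in rightwards (inj₁ (x₁a≤x₀b , adjacent-beside adj x₁a≤x₀b))
  ◀⇒◁ᵢ (inj₂ (inj₁ (adj , a-below-b))) =
    let y₁a≤y₀b = below⇒y₁≤y₀ a-below-b in upwards (inj₂ (adjacent-stacked adj y₁a≤y₀b , y₁a≤y₀b))
  ◀⇒◁ᵢ (inj₂ (inj₂ (inj₁ (seg , y₁a<y₀b)))) =
    upwards (inj₁ (≤-reflexive (sym (rightLeft⇒x₁≡x₀ seg)) , y₁a<y₀b))
  ◀⇒◁ᵢ (inj₂ (inj₂ (inj₂ (seg , x₁a<x₀b)))) =
    rightwards (inj₂ (x₁a<x₀b , ≤-reflexive (sym (topBottom⇒y₁≡y₀ seg))))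

  ◁ᵢ-irreflexive : Irreflexive _≡_ (TransClosure _◁ᵢ_)
  ◁ᵢ-irreflexive = TransClosure-irreflexive (DecTotalOrder.totalOrder ≤-decTotalOrder)
    _◁ᵢ_ _≟_ (λ i → x₁ (rect i)) ◁-asym
    (λ t◁m m◁w x₁m≤x₁t x₁m≤x₁w t≢w → ◁-bypass t◁m m◁w x₁m≤x₁t x₁m≤x₁w (separated t≢w))

  ≺ₛ-irreflexive : Irreflexive _≡_ (_≺ₛ_ ℛ)
  ≺ₛ-irreflexive x≡y = ◁ᵢ-irreflexive x≡y ∘ TransClosure-map ◀⇒◁ᵢ

proposition4p1 : (n : ℕ) (ℛ : Rectangulation n) → NWSELabeling ℛ →
    IsStrictPartialOrder {A = Fin n} _≡_ (_≺ₛ_ ℛ)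
proposition4p1 n ℛ _ = record
  { isEquivalence = isEquivalence
  ; irrefl        = ≺ₛ-irreflexive ℛ
  ; trans         = transitive (_◀_ ℛ)
  ; <-resp-≈      = resp₂ (_≺ₛ_ ℛ)
  }
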